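{- Let $k\ge 3$ be an integer and let $S=(1,3,\ldots,3,4)$ be the sequence consisting of one integer $1$, followed by $k-1$ copies of the integer $3$, followed by one integer $4$. There exists a bipartite outerplanar graph $G$ with $\Delta(G)\le k$ which is not $S$-packing colorable.
   Context: All graphs are finite and simple; $\Delta(G)$ denotes the maximum degree of $G$. A graph is outerplanar if it has a planar drawing in which all vertices lie on the outer face. For a positive integer $d$, a set $A\subseteq V(G)$ is a $d$-packing if any two distinct vertices of $A$ are at distance greater than $d$ in $G$. For a nondecreasing sequence $S=(s_1,\ldots,s_m)$ of positive integers, an $S$-packing coloring of $G$ is a map $c:V(G)\to\{1,\ldots,m\}$ such that for every $i$, the set $c^{ -1}(i)$ is an $s_i$-packing; $G$ is $S$-packing colorable if such a map exists. -}

module Defs where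

open import Data.Nat using (ℕ; suc; _≤_; _<_; _≟_)
open import Relation.Nullary using (yes; no)
open import Data.Fin using (Fin; toℕ; zero)
import Data.Fin as F
open import Data.Bool using (Bool; true; false; T; if_then_else_)
open import Data.List using (List; map; allFin)
open import Data.Nat.ListAction using (sum)
open import Data.Product using (Σ; ∃; ∃-syntax; _×_; _,_)
open import Relation.Nullary using (¬_)
open import Relation.Binary.PropositionalEquality using (_≡_; _≢_)
open import Function.Definitions using (Injective)

record Graph : Set where
  field
    n     : ℕ
    adj   : Fin n → Fin n → Bool
    sym   : ∀ u v → adj u v ≡ adj v u
    irrefl : ∀ u → adj u u ≡ false
open Graph public

degree : (G : Graph) → Fin (n G) → ℕ
degree G u = sum (map (λ v → if adj G u v then 1 else 0) (allFin (n G)))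

MaxDegreeAtMost : Graph → ℕ → Set
MaxDegreeAtMost G k = ∀ u → degree G u ≤ k

data Walk (G : Graph) : Fin (n G) → Fin (n G) → ℕ → Set where
  here : ∀ {u} → Walk G u u 0
  step : ∀ {u w v ℓ} → T (adj G u w) → Walk G w v ℓ → Walk G u v (suc ℓ)

DistAtMost : (G : Graph) → Fin (n G) → Fin (n G) → ℕ → Set
DistAtMost G u v d = ∃[ ℓ ] (ℓ ≤ d × Walk G u v ℓ)

DistGreater : (G : Graph) → Fin (n G) → Fin (n G) → ℕ → Set
DistGreater G u v d = ¬ DistAtMost G u v d

IsPacking : (G : Graph) → ℕ → (Fin (n G) → Set) → Set
IsPacking G d A = ∀ u v → A u → A v → u ≢ v → DistGreater G u v d

IsSPackingColoring : (G : Graph) {m : ℕ} → (Fin m → ℕ) → (Fin (n G) → Fin m) → Set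
IsSPackingColoring G s c = ∀ i → IsPacking G (s i) (λ u → c u ≡ i)

SPackingColorable : (G : Graph) {m : ℕ} → (Fin m → ℕ) → Set
SPackingColorable G s = ∃[ c ] IsSPackingColoring G s c

-- The sequence S = (1, 3, …, 3, 4) of length k+1: one 1, k-1 threes, one 4.
-- Indexed by Fin (suc k): index 0 ↦ 1, index k ↦ 4, others ↦ 3 (for k ≥ 1).
seqS : (k : ℕ) → Fin (suc k) → ℕ
seqS k zero = 1
seqS k (F.suc i) with toℕ (F.suc i) ≟ k
... | yes _ = 4
... | no  _ = 3

Bipartite : Graph → Set
Bipartite G = Σ (Fin (n G) → Bool) λ f → (∀ u v → T (adj G u v) → f u ≢ f v)

-- Outerplanar: vertices can be placed in convex position on a circle
-- (positions given by a bijection σ : Fin n → Fin n, read cyclically)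
-- so that no two edges, drawn as chords, cross.  Chords ab and cd cross
-- iff (after relabelling endpoints) σa < σc < σb < σd.
Outerplanar : Graph → Set
Outerplanar G =
  Σ (Fin (n G) → Fin (n G)) λ σ → (Injective _≡_ _≡_ σ ×
          (∀ a b c d → T (adj G a b) → T (adj G c d) →
             ¬ (toℕ (σ a) < toℕ (σ c) × toℕ (σ c) < toℕ (σ b) × toℕ (σ b) < toℕ (σ d))))

{-# OPTIONS --safe #-}

-- Colour 0 is the 1-packing and colour k the 4-packing.  If a vertex of colour 0 has k
-- neighbours, these are pairwise at distance 2 and not of colour 0, so they use each of the
-- colours 1, …, k exactly once; consequently every other vertex within distance 2 of that centre
-- is within distance 3 of a neighbour of each nonzero colour and must have colour 0 as well.
-- The graph is a tree: a root with k branches, each a path of three hubs of degree k carrying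
-- pendant leaves.  The closed neighbourhood of the root contains a vertex of colour 0, and in
-- each case this produces two colour-0 hubs at distance 2 whose neighbours of colour k are
-- distinct and at distance at most 4.

module Submission where

open import Defs hiding (sym)
open import Data.Bool using (Bool; true; false; T; if_then_else_; _∨_)
open import Data.Bool.Properties using (∨-comm; T-∨)
open import Data.Empty using (⊥; ⊥-elim)
open import Data.Fin as Fin using (Fin; zero; suc; toℕ; punchOut; combine; remQuot)
open import Data.Fin.Patterns using (0F; 1F; 2F)
open import Data.Fin.Properties
  using (_≟_; any?; suc-injective; toℕ<n; toℕ-fromℕ; toℕ-inject₁; punchOut-injective; injective⇒≤;
         toℕ-combine; combine-monoˡ-<; remQuot-combine; combine-remQuot)
  renaming (≤-antisym to Fin-≤-antisym)
open import Data.List using (List; []; _∷_; length; tabulate; map; allFin)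
open import Data.List.Membership.Propositional using (_∈_)
open import Data.List.Membership.Propositional.Properties using (∈-map⁺; ∈-allFin)
open import Data.List.Properties using (map-tabulate; length-map; length-tabulate)
open import Data.List.Relation.Unary.Any as Any using ()
open import Data.Nat as ℕ using (ℕ; zero; suc; _+_; _*_; _≤_; _<_; z≤n; s≤s)
open import Data.Nat.ListAction using (sum)
open import Data.Nat.Properties
  using (≤-refl; ≤-trans; ≤-reflexive; ≤-pred; <-trans; <-≤-trans; <-asym; <⇒≤; <⇒≱; ≮⇒≥; n≤1+n; n<1+n;
         m≤m+n; +-comm; +-monoʳ-<; +-cancelˡ-<; *-zeroʳ; *-suc; *-cancelˡ-<; module ≤-Reasoning)
open import Data.Product using (Σ; _×_; _,_; proj₁; proj₂; ∃-syntax; uncurry; map₂)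
open import Data.Sum using (_⊎_; inj₁; inj₂)
open import Data.Unit using (tt)
open import Function using (_∘_)
open import Function.Bundles using (Equivalence)
open import Function.Definitions using (Injective)
open import Relation.Binary.PropositionalEquality
  using (_≡_; _≢_; refl; sym; trans; cong; cong₂; subst; subst₂; module ≡-Reasoning)
open import Relation.Nullary using (¬_; yes; no)
open import Relation.Nullary.Decidable using (⌊_⌋; toWitness; fromWitness)

Adj : (G : Graph) → Fin (n G) → Fin (n G) → Set
Adj G u v = T (adj G u v)

adj-sym : ∀ G {u v} → Adj G u v → Adj G v u
adj-sym G {u} {v} = subst T (Graph.sym G u v)

adj⇒≢ : ∀ G {u v} → Adj G u v → u ≢ v
adj⇒≢ G {u} a refl = subst T (irrefl G u) a

module _ {G : Graph} where

  edge : ∀ {u v} → Adj G u v → Walk G u v 1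
  edge a = step a here

  infixr 5 _++ʷ_
  _++ʷ_ : ∀ {u v w ℓ ℓ′} → Walk G u v ℓ → Walk G v w ℓ′ → Walk G u w (ℓ + ℓ′)
  here     ++ʷ q = q
  step a p ++ʷ q = step a (p ++ʷ q)

dropZero : ∀ {n} → List (Fin (suc n)) → List (Fin n)
dropZero []          = []
dropZero (zero  ∷ xs) = dropZero xs
dropZero (suc x ∷ xs) = x ∷ dropZero xs

length-dropZero : ∀ {n} (xs : List (Fin (suc n))) → length (dropZero xs) ≤ length xs
length-dropZero []           = z≤n
length-dropZero (zero  ∷ xs) = ≤-trans (length-dropZero xs) (n≤1+n _)
length-dropZero (suc x ∷ xs) = s≤s (length-dropZero xs)

length-dropZero-< : ∀ {n} (xs : List (Fin (suc n))) → zero ∈ xs → length (dropZero xs) < length xs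
length-dropZero-< (zero  ∷ xs) _               = s≤s (length-dropZero xs)
length-dropZero-< (suc x ∷ xs) (Any.there 0∈xs) = s≤s (length-dropZero-< xs 0∈xs)

∈-dropZero : ∀ {n} {x : Fin n} xs → suc x ∈ xs → x ∈ dropZero xs
∈-dropZero (zero  ∷ xs) (Any.there p)    = ∈-dropZero xs p
∈-dropZero (suc y ∷ xs) (Any.here refl)  = Any.here refl
∈-dropZero (suc y ∷ xs) (Any.there p)    = Any.there (∈-dropZero xs p)

count≤length : ∀ {n} (p : Fin n → Bool) (xs : List (Fin n)) → (∀ v → T (p v) → v ∈ xs) →
               sum (tabulate (λ v → if p v then 1 else 0)) ≤ length xs
count≤length {zero}  p xs listed = z≤n
count≤length {suc n} p xs listed
  with rest ← count≤length (p ∘ suc) (dropZero xs) (λ v pv → ∈-dropZero xs (listed (suc v) pv))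
     | p zero in p0
... | true  = <-≤-trans (s≤s rest) (length-dropZero-< xs (listed zero (subst T (sym p0) tt)))
... | false = ≤-trans rest (length-dropZero xs)

degree≤length : ∀ G u (xs : List (Fin (n G))) → (∀ v → Adj G u v → v ∈ xs) → degree G u ≤ length xs
degree≤length G u xs listed =
  subst (_≤ length xs) (cong sum (sym (map-tabulate (λ v → v) (λ v → if adj G u v then 1 else 0))))
        (count≤length (adj G u) xs listed)

module _ {n m : ℕ} {p : Fin (suc m)} (f : Fin n → Fin (suc m)) (misses-p : ∀ i → f i ≢ p) where

  p≢f : ∀ i → p ≢ f i
  p≢f i p≡fi = misses-p i (sym p≡fi)

  squeeze : Fin n → Fin m
  squeeze i = punchOut (p≢f i)

  squeeze-injective : Injective _≡_ _≡_ f → Injective _≡_ _≡_ squeeze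
  squeeze-injective f-inj {i} {j} e = f-inj (punchOut-injective (p≢f i) (p≢f j) e)

  squeeze-misses : ∀ {q} (p≢q : p ≢ q) → (∀ i → f i ≢ q) → ∀ i → squeeze i ≢ punchOut p≢q
  squeeze-misses p≢q misses-q i e = misses-q i (punchOut-injective (p≢f i) p≢q e)

-- Squeezing out two distinct missed values would inject Fin (suc n) into Fin n.
injective-misses-one : ∀ {n} (f : Fin n → Fin (suc n)) → Injective _≡_ _≡_ f →
                       ∀ {p q} → (∀ i → f i ≢ p) → (∀ i → f i ≢ q) → p ≡ q
injective-misses-one {zero} f f-inj {zero} {zero} _ _ = refl
injective-misses-one {suc n} f f-inj {p} {q} misses-p misses-q with p ≟ q
... | yes p≡q = p≡q
... | no  p≢q = ⊥-elim (<⇒≱ (n<1+n n) (injective⇒≤ g-inj))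
  where
  g-inj = squeeze-injective (squeeze f misses-p) (squeeze-misses f misses-p p≢q misses-q)
            (squeeze-injective f misses-p f-inj)

seqS-suc : ∀ k (i : Fin k) → 3 ≤ seqS k (suc i)
seqS-suc k i with toℕ (suc i) ℕ.≟ k
... | yes _ = s≤s (s≤s (s≤s z≤n))
... | no  _ = ≤-refl

seqS-≢zero : ∀ k {x : Fin (suc k)} → x ≢ zero → 3 ≤ seqS k x
seqS-≢zero k {zero}  x≢0 = ⊥-elim (x≢0 refl)
seqS-≢zero k {suc i} _   = seqS-suc k i

seqS-positive : ∀ k (x : Fin (suc k)) → 1 ≤ seqS k x
seqS-positive k zero    = ≤-refl
seqS-positive k (suc i) = ≤-trans (s≤s z≤n) (seqS-suc k i)

seqS-last : ∀ k → seqS (suc k) (Fin.fromℕ (suc k)) ≡ 4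
seqS-last k with toℕ (suc (Fin.fromℕ k)) ℕ.≟ suc k
... | yes _   = refl
... | no  ≢k = ⊥-elim (≢k (cong suc (toℕ-fromℕ k)))

record Star (G : Graph) (k : ℕ) (centre : Fin (n G)) : Set where
  field
    leaf           : Fin k → Fin (n G)
    leaf-adj       : ∀ j → Adj G centre (leaf j)
    leaf-injective : Injective _≡_ _≡_ leaf

module PackingColouring {G : Graph} {k : ℕ} {c : Fin (n G) → Fin (suc k)}
                        (isColouring : IsSPackingColoring G (seqS k) c) where

  close⇒colours-≢ : ∀ {u v ℓ} → u ≢ v → Walk G u v ℓ → ℓ ≤ seqS k (c u) → c u ≢ c v
  close⇒colours-≢ {u} {v} {ℓ} u≢v walk ℓ≤s cu≡cv =
    isColouring (c u) u v refl (sym cu≡cv) u≢v (ℓ , ℓ≤s , walk)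

  adj⇒colours-≢ : ∀ {u v} → Adj G u v → c u ≢ c v
  adj⇒colours-≢ {u} a = close⇒colours-≢ (adj⇒≢ G a) (edge a) (seqS-positive k (c u))

  module _ {u} (S : Star G k u) where
    open Star S

    centre-zero⇒leaves-≢zero : c u ≡ zero → ∀ j → c (leaf j) ≢ zero
    centre-zero⇒leaves-≢zero cu≡0 j cl≡0 = adj⇒colours-≢ (leaf-adj j) (trans cu≡0 (sym cl≡0))

    leaf-colours-injective : (∀ j → c (leaf j) ≢ zero) → Injective _≡_ _≡_ (c ∘ leaf)
    leaf-colours-injective leaves≢0 {i} {j} ci≡cj with i ≟ j
    ... | yes i≡j = i≡j
    ... | no  i≢j = ⊥-elim (close⇒colours-≢ (i≢j ∘ leaf-injective)
                              (edge (adj-sym G (leaf-adj i)) ++ʷ edge (leaf-adj j))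
                              (≤-trans (n≤1+n 2) (seqS-≢zero k (leaves≢0 i))) ci≡cj)

    leaf-colours-exhaustive : (∀ j → c (leaf j) ≢ zero) → ∀ x → x ≢ zero → ∃[ j ] c (leaf j) ≡ x
    leaf-colours-exhaustive leaves≢0 x x≢0 with any? (λ j → c (leaf j) ≟ x)
    ... | yes found = found
    ... | no  none  = ⊥-elim (x≢0 (injective-misses-one (c ∘ leaf) (leaf-colours-injective leaves≢0)
                                    (λ j cl≡x → none (j , cl≡x)) leaves≢0))

    star-has-zero : c u ≡ zero ⊎ ∃[ j ] c (leaf j) ≡ zero
    star-has-zero with any? (λ j → c (leaf j) ≟ zero)
    ... | yes found = inj₂ found
    ... | no  none  = inj₁ (sym (injective-misses-one (c ∘ leaf) (leaf-colours-injective leaves≢0)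
                                   leaves≢0 (λ j cl≡cu → adj⇒colours-≢ (leaf-adj j) (sym cl≡cu))))
      where
      leaves≢0 : ∀ j → c (leaf j) ≢ zero
      leaves≢0 j cl≡0 = none (j , cl≡0)

    forced-zero : c u ≡ zero → ∀ {w} → Walk G w u 2 → (∀ j → w ≢ leaf j) → c w ≡ zero
    forced-zero cu≡0 {w} w~u w∉S with c w ≟ zero
    ... | yes cw≡0 = cw≡0
    ... | no  cw≢0 with leaf-colours-exhaustive (centre-zero⇒leaves-≢zero cu≡0) (c w) cw≢0
    ...   | j , cl≡cw =
      ⊥-elim (close⇒colours-≢ (w∉S j) (w~u ++ʷ edge (leaf-adj j)) (seqS-≢zero k cw≢0) (sym cl≡cw))

  -- w is forced to colour 0, so x also occurs at a leaf of S′, at distance 1 + 2 + 1 from leaf S j.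
  two-stars-clash : ∀ {u w} (S : Star G k u) (S′ : Star G k w) → c u ≡ zero →
                    Walk G w u 2 → (∀ j → w ≢ Star.leaf S j) →
                    ∀ j {x} → c (Star.leaf S j) ≡ x → 4 ≤ seqS k x →
                    (∀ j′ → Star.leaf S′ j′ ≢ Star.leaf S j) → ⊥
  two-stars-clash S S′ cu≡0 w~u w∉S j {x} cl≡x 4≤sx S′≢ =
    close⇒colours-≢ (S′≢ j′) walk (subst (λ y → 4 ≤ seqS k y) (sym cl′≡x) 4≤sx) (trans cl′≡x (sym cl≡x))
    where
    open Star
    x≢0 : x ≢ zero
    x≢0 refl = <⇒≱ (s≤s (s≤s z≤n)) 4≤sx
    cw≡0 = forced-zero S cu≡0 w~u w∉S
    found = leaf-colours-exhaustive S′ (centre-zero⇒leaves-≢zero S′ cw≡0) x x≢0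
    j′  = proj₁ found
    cl′≡x = proj₂ found
    walk : Walk G (leaf S′ j′) (leaf S j) 4
    walk = edge (adj-sym G (leaf-adj S′ j′)) ++ʷ w~u ++ʷ edge (leaf-adj S j)

*-≤-+⇒≤ : ∀ M {a b y} → y < M → M * a ≤ M * b + y → a ≤ b
*-≤-+⇒≤ M {a} {b} {y} y<M Ma≤Mb+y = ≤-pred (*-cancelˡ-< M a (suc b) (begin-strict
  M * a      ≤⟨ Ma≤Mb+y ⟩
  M * b + y  <⟨ +-monoʳ-< (M * b) y<M ⟩
  M * b + M  ≡⟨ +-comm (M * b) M ⟩
  M + M * b  ≡⟨ *-suc M b ⟨
  M * suc b  ∎))
  where open ≤-Reasoning

combine-≤⇒≤ˡ : ∀ {a b} {i i′ : Fin a} {j j′ : Fin b} →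
               toℕ (combine i j) ≤ toℕ (combine i′ j′) → toℕ i ≤ toℕ i′
combine-≤⇒≤ˡ {i = i} {i′} {j} {j′} cij≤ci′j′ with toℕ i′ ℕ.<? toℕ i
... | yes i′<i = ⊥-elim (<⇒≱ (combine-monoˡ-< j′ j i′<i) cij≤ci′j′)
... | no  i′≮i = ≮⇒≥ i′≮i

combine-cancelˡ-< : ∀ {a b} (i : Fin a) {j j′ : Fin b} →
                    toℕ (combine i j) < toℕ (combine i j′) → toℕ j < toℕ j′
combine-cancelˡ-< {b = b} i {j} {j′} cij<cij′ =
  +-cancelˡ-< (b * toℕ i) (toℕ j) (toℕ j′)
    (subst₂ _<_ (toℕ-combine i j) (toℕ-combine i j′) cij<cij′)

module ParentTree {N : ℕ} (parent : Fin N → Fin (suc N)) (parent-≤ : ∀ v → toℕ (parent v) ≤ toℕ v) where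

  isChildOf : Fin (suc N) → Fin (suc N) → Bool
  isChildOf zero    _ = false
  isChildOf (suc v) u = ⌊ parent v ≟ u ⌋

  parent≢self : ∀ v → parent v ≢ suc v
  parent≢self v p≡v = <⇒≱ (n<1+n (toℕ v)) (subst (λ (u : Fin (suc N)) → toℕ u ≤ toℕ v) p≡v (parent-≤ v))

  tree : Graph
  tree = record
    { n      = suc N
    ; adj    = λ u v → isChildOf u v ∨ isChildOf v u
    ; sym    = λ u v → ∨-comm (isChildOf u v) (isChildOf v u)
    ; irrefl = loopless
    }
    where
    loopless : ∀ u → isChildOf u u ∨ isChildOf u u ≡ false
    loopless zero = refl
    loopless (suc v) with parent v ≟ suc v
    ... | yes p≡v = ⊥-elim (parent≢self v p≡v)
    ... | no  _   = refl

  data _IsParentOf_ : Fin (suc N) → Fin (suc N) → Set where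
    parent-of : ∀ v → parent v IsParentOf suc v

  child-adj : ∀ v → Adj tree (suc v) (parent v)
  child-adj v = Equivalence.from (T-∨ {isChildOf (suc v) (parent v)}) (inj₁ (fromWitness refl))

  isChildOf⇒IsParentOf : ∀ u v → T (isChildOf u v) → v IsParentOf u
  isChildOf⇒IsParentOf (suc u) v isChild with refl ← toWitness isChild = parent-of u

  adj⇒IsParentOf : ∀ u v → Adj tree u v → u IsParentOf v ⊎ v IsParentOf u
  adj⇒IsParentOf u v a with Equivalence.to T-∨ a
  ... | inj₁ u-child = inj₂ (isChildOf⇒IsParentOf u v u-child)
  ... | inj₂ v-child = inj₁ (isChildOf⇒IsParentOf v u v-child)

  parent-precedes : ∀ {u v} → u IsParentOf v → toℕ u < toℕ v
  parent-precedes (parent-of v) = s≤s (parent-≤ v)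

  grandparent≢child : ∀ {u w} → parent w ≡ suc u → parent u ≢ suc w
  grandparent≢child {u} {w} pw≡u pu≡w = <-asym (below pu≡w (parent-≤ u)) (below pw≡u (parent-≤ w))
    where
    below : ∀ {x y} {z : Fin (suc N)} → z ≡ suc x → toℕ z ≤ toℕ y → toℕ x < toℕ y
    below refl x<y = x<y

  tree-bipartite : (side : Fin (suc N) → Bool) → (∀ v → side (parent v) ≢ side (suc v)) → Bipartite tree
  tree-bipartite side alternates = side , proper
    where
    proper : ∀ u v → Adj tree u v → side u ≢ side v
    proper u v a with adj⇒IsParentOf u v a
    ... | inj₁ (parent-of w) = alternates w
    ... | inj₂ (parent-of w) = alternates w ∘ sym

  tree-outerplanar : (∀ b d → toℕ (parent b) < toℕ (parent d) → toℕ (parent d) < toℕ (suc b) →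
                              toℕ (suc b) < toℕ (suc d) → ⊥) →
                     Outerplanar tree
  tree-outerplanar nested = (λ v → v) , (λ e → e) , no-crossing
    where
    no-crossing : ∀ a b c d → Adj tree a b → Adj tree c d → ¬ (toℕ a < toℕ c × toℕ c < toℕ b × toℕ b < toℕ d)
    no-crossing a b c d ab cd (a<c , c<b , b<d) with adj⇒IsParentOf a b ab | adj⇒IsParentOf c d cd
    ... | inj₂ b→a             | _                    = <-asym (parent-precedes b→a) (<-trans a<c c<b)
    ... | inj₁ _               | inj₂ d→c             = <-asym (parent-precedes d→c) (<-trans c<b b<d)
    ... | inj₁ (parent-of b′) | inj₁ (parent-of d′) = nested b′ d′ a<c c<b b<d

module Counterexample (k′ : ℕ) where

  k L m N : ℕ
  k = 3 + k′
  L = 2 + k′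
  m = suc (3 * L)
  N = k * m

  -- Below the root there are k branches.  A branch is a path of three hubs;
  -- child h j is the j-th child of hub h, and the last child of hubs 0 and 1
  -- is the next hub.  Every hub thus has its parent and L = k - 1 children.
  data Slot : Set where
    top   : Slot
    child : Fin 3 → Fin L → Slot

  hub : Fin 3 → Slot
  hub 0F      = top
  hub (suc h) = child (Fin.inject₁ h) (Fin.fromℕ (suc k′))

  child-injective : ∀ {h j j′} → child h j ≡ child h j′ → j ≡ j′
  child-injective refl = refl

  -- child h j sits at position 1 + L h + j of its branch, so hub h sits at L h and the parent
  -- of every slot is the last hub before it: this is why parent edges never cross.
  encSlot : Slot → Fin m
  encSlot top         = zero
  encSlot (child h j) = suc (combine h j)

  decSlot : Fin m → Slot
  decSlot zero    = top
  decSlot (suc p) = uncurry child (remQuot {3} L p)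

  decSlot-encSlot : ∀ s → decSlot (encSlot s) ≡ s
  decSlot-encSlot top         = refl
  decSlot-encSlot (child h j) = cong (uncurry child) (remQuot-combine h j)

  encSlot-decSlot : ∀ p → encSlot (decSlot p) ≡ p
  encSlot-decSlot zero    = refl
  encSlot-decSlot (suc p) = cong suc (combine-remQuot {3} L p)

  encode : Fin k → Slot → Fin N
  encode i s = combine i (encSlot s)

  decode : Fin N → Fin k × Slot
  decode v = map₂ decSlot (remQuot {k} m v)

  decode-encode : ∀ i s → decode (encode i s) ≡ (i , s)
  decode-encode i s = trans (cong (map₂ decSlot) (remQuot-combine i (encSlot s)))
                            (cong (i ,_) (decSlot-encSlot s))

  encode-decode : ∀ v → uncurry encode (decode v) ≡ v
  encode-decode v = trans (cong (combine (proj₁ q)) (encSlot-decSlot (proj₂ q))) (combine-remQuot {k} m v)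
    where q = remQuot {k} m v

  data Encoded : Fin N → Set where
    encoded : ∀ i s → Encoded (encode i s)

  as-encoded : ∀ v → Encoded v
  as-encoded v = subst Encoded (encode-decode v) (encoded (proj₁ (decode v)) (proj₂ (decode v)))

  root : Fin (suc N)
  root = zero

  node : Fin k → Slot → Fin (suc N)
  node i s = suc (encode i s)

  node-injective : ∀ {i i′ s s′} → node i s ≡ node i′ s′ → i ≡ i′ × s ≡ s′
  node-injective {i} {i′} {s} {s′} e = cong proj₁ same , cong proj₂ same
    where
    same : (i , s) ≡ (i′ , s′)
    same = trans (sym (decode-encode i s)) (trans (cong decode (suc-injective e)) (decode-encode i′ s′))

  node-branch-≢ : ∀ i s i′ s′ → i ≢ i′ → node i s ≢ node i′ s′
  node-branch-≢ i s i′ s′ i≢i′ = i≢i′ ∘ proj₁ ∘ node-injective {i} {i′} {s} {s′}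

  node-slot-≢ : ∀ i s i′ s′ → s ≢ s′ → node i s ≢ node i′ s′
  node-slot-≢ i s i′ s′ s≢s′ = s≢s′ ∘ proj₂ ∘ node-injective {i} {i′} {s} {s′}

  parentOf : Fin k → Slot → Fin (suc N)
  parentOf i top         = root
  parentOf i (child h _) = node i (hub h)

  parent : Fin N → Fin (suc N)
  parent v = uncurry parentOf (decode v)

  parent-encode : ∀ i s → parent (encode i s) ≡ parentOf i s
  parent-encode i s = cong (uncurry parentOf) (decode-encode i s)

  toℕ-encode : ∀ i s → toℕ (encode i s) ≡ m * toℕ i + toℕ (encSlot s)
  toℕ-encode i s = toℕ-combine i (encSlot s)

  toℕ-hub : ∀ h → toℕ (encSlot (hub h)) ≡ L * toℕ h
  toℕ-hub zero    = sym (*-zeroʳ L)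
  toℕ-hub (suc h) = begin
    suc (toℕ (combine (Fin.inject₁ h) (Fin.fromℕ (suc k′))))  ≡⟨ cong suc (toℕ-combine (Fin.inject₁ h) (Fin.fromℕ (suc k′))) ⟩
    suc (L * toℕ (Fin.inject₁ h) + toℕ (Fin.fromℕ (suc k′)))  ≡⟨ cong₂ (λ a b → suc (L * a + b)) (toℕ-inject₁ h) (toℕ-fromℕ _) ⟩
    suc (L * toℕ h + suc k′)                                   ≡⟨ cong suc (+-comm (L * toℕ h) _) ⟩
    L + L * toℕ h                                              ≡⟨ *-suc L (toℕ h) ⟨
    L * suc (toℕ h)                                            ∎
    where open ≡-Reasoning

  hub<child : ∀ h j → toℕ (encSlot (hub h)) < toℕ (encSlot (child h j))
  hub<child h j rewrite toℕ-hub h | toℕ-combine h j = s≤s (m≤m+n (L * toℕ h) (toℕ j))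

  parentOf-precedes : ∀ i s → toℕ (parentOf i s) ≤ toℕ (encode i s)
  parentOf-precedes i top         = z≤n
  parentOf-precedes i (child h j) rewrite toℕ-encode i (hub h) | toℕ-encode i (child h j) =
    +-monoʳ-< (m * toℕ i) (hub<child h j)

  parent-≤ : ∀ v → toℕ (parent v) ≤ toℕ v
  parent-≤ v with as-encoded v
  ... | encoded i s rewrite parent-encode i s = parentOf-precedes i s

  open ParentTree parent parent-≤ public

  up : ∀ i s → Adj tree (node i s) (parentOf i s)
  up i s = subst (Adj tree (node i s)) (parent-encode i s) (child-adj (encode i s))

  down : ∀ i s → Adj tree (parentOf i s) (node i s)
  down i s = adj-sym tree {node i s} (up i s)

  oddDepth : Slot → Bool
  oddDepth top          = true
  oddDepth (child 0F _) = false
  oddDepth (child 1F _) = true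
  oddDepth (child 2F _) = false

  side : Fin (suc N) → Bool
  side zero    = false
  side (suc v) = oddDepth (proj₂ (decode v))

  side-node : ∀ i s → side (node i s) ≡ oddDepth s
  side-node i s = cong (oddDepth ∘ proj₂) (decode-encode i s)

  side-parentOf : ∀ i s → side (parentOf i s) ≢ oddDepth s
  side-parentOf i top          ()
  side-parentOf i (child 0F _) rewrite side-node i (hub 0F) = λ ()
  side-parentOf i (child 1F _) rewrite side-node i (hub 1F) = λ ()
  side-parentOf i (child 2F _) rewrite side-node i (hub 2F) = λ ()

  bipartite : Bipartite tree
  bipartite = tree-bipartite side alternates
    where
    alternates : ∀ v → side (parent v) ≢ side (suc v)
    alternates v with as-encoded v
    ... | encoded i s = λ same → side-parentOf i s (begin
      side (parentOf i s)         ≡⟨ cong side (parent-encode i s) ⟨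
      side (parent (encode i s))  ≡⟨ same ⟩
      side (node i s)             ≡⟨ side-node i s ⟩
      oddDepth s                  ∎)
      where open ≡-Reasoning

  hubs-nested : ∀ h j h′ → toℕ (encSlot (hub h)) < toℕ (encSlot (hub h′)) →
                toℕ (encSlot (hub h′)) < toℕ (encSlot (child h j)) → ⊥
  hubs-nested h j h′ hub<hub′ hub′<child rewrite toℕ-hub h | toℕ-hub h′ | toℕ-combine h j =
    <⇒≱ (*-cancelˡ-< L (toℕ h) (toℕ h′) hub<hub′) (*-≤-+⇒≤ L (toℕ<n j) (≤-pred hub′<child))

  parents-nested-in-branch : ∀ i s h′ j′ → toℕ (parentOf i s) < toℕ (parentOf i (child h′ j′)) →
                             toℕ (parentOf i (child h′ j′)) ≤ toℕ (encode i s) → ⊥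
  parents-nested-in-branch i top         h′ j′ p<p′ p′≤b with () ← combine-cancelˡ-< i p′≤b
  parents-nested-in-branch i (child h j) h′ j′ p<p′ p′≤b =
    hubs-nested h j h′ (combine-cancelˡ-< i (≤-pred p<p′)) (combine-cancelˡ-< i p′≤b)

  parents-nested : ∀ i s i′ s′ → toℕ (parentOf i s) < toℕ (parentOf i′ s′) →
                   toℕ (parentOf i′ s′) ≤ toℕ (encode i s) → toℕ (encode i s) < toℕ (encode i′ s′) → ⊥
  parents-nested i s i′ top ()
  parents-nested i s i′ (child h′ j′) p<p′ p′≤b b<d
    with refl ← Fin-≤-antisym {i = i} {j = i′} (combine-≤⇒≤ˡ (<⇒≤ b<d)) (combine-≤⇒≤ˡ (<⇒≤ p′≤b))
    = parents-nested-in-branch i s h′ j′ p<p′ p′≤b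

  outerplanar : Outerplanar tree
  outerplanar = tree-outerplanar nested
    where
    nested : ∀ b d → toℕ (parent b) < toℕ (parent d) → toℕ (parent d) < toℕ (suc b) →
             toℕ (suc b) < toℕ (suc d) → ⊥
    nested b d with as-encoded b | as-encoded d
    ... | encoded i s | encoded i′ s′ rewrite parent-encode i s | parent-encode i′ s′ =
      λ p<p′ p′<b b<d → parents-nested i s i′ s′ p<p′ (≤-pred p′<b) (≤-pred b<d)

  childLevel : Slot → Fin 3
  childLevel top               = 0F
  childLevel (child 0F _)      = 1F
  childLevel (child (suc _) _) = 2F

  childLevel-hub : ∀ h → childLevel (hub h) ≡ h
  childLevel-hub 0F = refl
  childLevel-hub 1F = refl
  childLevel-hub 2F = refl

  -- For a slot that is not a hub these are not its children; an over-approximation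
  -- of the neighbourhood is all the degree bound needs.
  childrenOf : Fin k → Slot → List (Fin (suc N))
  childrenOf i s = map (λ j → node i (child (childLevel s) j)) (allFin L)

  neighbourhood : Fin (suc N) → List (Fin (suc N))
  neighbourhood zero    = map (λ i → node i top) (allFin k)
  neighbourhood (suc v) = parent v ∷ uncurry childrenOf (decode v)

  length-neighbourhood : ∀ u → length (neighbourhood u) ≡ k
  length-neighbourhood zero    = trans (length-map _ (allFin k)) (length-tabulate (λ i → i))
  length-neighbourhood (suc v) = cong suc (trans (length-map _ (allFin L)) (length-tabulate (λ j → j)))

  neighbourhood-node : ∀ i s → neighbourhood (node i s) ≡ parentOf i s ∷ childrenOf i s
  neighbourhood-node i s = cong₂ _∷_ (parent-encode i s) (cong (uncurry childrenOf) (decode-encode i s))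

  child-in-childrenOf-hub : ∀ i h j → node i (child h j) ∈ childrenOf i (hub h)
  child-in-childrenOf-hub i h j =
    subst (λ l → node i (child h j) ∈ map (λ j′ → node i (child l j′)) (allFin L)) (sym (childLevel-hub h))
          (∈-map⁺ (λ j′ → node i (child h j′)) (∈-allFin j))

  child-in-neighbourhood : ∀ i s → node i s ∈ neighbourhood (parentOf i s)
  child-in-neighbourhood i top         = ∈-map⁺ (λ i′ → node i′ top) (∈-allFin i)
  child-in-neighbourhood i (child h j) =
    subst (node i (child h j) ∈_) (sym (neighbourhood-node i (hub h))) (Any.there (child-in-childrenOf-hub i h j))

  parent-lists-child : ∀ v → suc v ∈ neighbourhood (parent v)
  parent-lists-child v with as-encoded v
  ... | encoded i s = subst (λ p → node i s ∈ neighbourhood p) (sym (parent-encode i s)) (child-in-neighbourhood i s)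

  neighbours-listed : ∀ u v → Adj tree u v → v ∈ neighbourhood u
  neighbours-listed u v a with adj⇒IsParentOf u v a
  ... | inj₁ (parent-of w) = parent-lists-child w
  ... | inj₂ (parent-of w) = Any.here refl

  max-degree : MaxDegreeAtMost tree k
  max-degree u = subst (degree tree u ≤_) (length-neighbourhood u)
                       (degree≤length tree u (neighbourhood u) (neighbours-listed u))

  rootStar : Star tree k root
  rootStar = record
    { leaf           = λ i → node i top
    ; leaf-adj       = λ i → down i top
    ; leaf-injective = proj₁ ∘ node-injective
    }

  hubStar : ∀ i h → Star tree k (node i (hub h))
  hubStar i h = record { leaf = leaf ; leaf-adj = leaf-adj ; leaf-injective = leaf-injective }
    where
    leaf : Fin k → Fin (suc N)
    leaf zero    = parentOf i (hub h)
    leaf (suc j) = node i (child h j)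

    leaf-adj : ∀ j → Adj tree (node i (hub h)) (leaf j)
    leaf-adj zero    = up i (hub h)
    leaf-adj (suc j) = down i (child h j)

    parent≢child : ∀ j → parentOf i (hub h) ≢ node i (child h j)
    parent≢child j = grandparent≢child (parent-encode i (child h j)) ∘ trans (parent-encode i (hub h))

    leaf-injective : Injective _≡_ _≡_ leaf
    leaf-injective {zero}  {zero}   _ = refl
    leaf-injective {zero}  {suc j}  e = ⊥-elim (parent≢child j e)
    leaf-injective {suc j} {zero}   e = ⊥-elim (parent≢child j (sym e))
    leaf-injective {suc j} {suc j′} e = cong suc (child-injective (proj₂ (node-injective {i} {i} {child h j} {child h j′} e)))

  other : Fin k → Fin k
  other zero    = suc zero
  other (suc _) = zero

  other-≢ : ∀ i → other i ≢ i
  other-≢ zero    ()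
  other-≢ (suc _) ()

  module _ {c : Fin (suc N) → Fin (suc k)} (isColouring : IsSPackingColoring tree (seqS k) c) where
    open PackingColouring isColouring

    last : Fin (suc k)
    last = Fin.fromℕ k

    4≤last : 4 ≤ seqS k last
    4≤last = ≤-reflexive (sym (seqS-last (2 + k′)))

    last≢zero : last ≢ zero
    last≢zero ()

    root-≢zero : c root ≢ zero
    root-≢zero root≡0
      with i , top≡last ← leaf-colours-exhaustive rootStar (centre-zero⇒leaves-≢zero rootStar root≡0) last last≢zero
      = two-stars-clash rootStar (hubStar a 1F) root≡0 (edge (up a (hub 1F)) ++ʷ edge (up a top))
          (λ i′ → node-slot-≢ a (hub 1F) i′ top λ ()) i top≡last 4≤last
          λ { zero    → node-branch-≢ a top i top (other-≢ i)
            ; (suc j) → node-slot-≢ a (child 1F j) i top λ () }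
      where
      a = other i

    top-≢zero : ∀ i → c (node i top) ≢ zero
    top-≢zero i top≡0
      with leaf-colours-exhaustive (hubStar i 0F) (centre-zero⇒leaves-≢zero (hubStar i 0F) top≡0) last last≢zero
    ... | zero , root≡last =
      two-stars-clash (hubStar i 0F) (hubStar i 2F) top≡0
        (edge (up i (hub 2F)) ++ʷ edge (up i (hub 1F)))
        (λ { zero → λ () ; (suc j) → node-slot-≢ i (hub 2F) i (child 0F j) λ () })
        zero root≡last 4≤last
        λ { zero → λ () ; (suc j) → λ () }
    ... | suc j , child≡last =
      two-stars-clash (hubStar i 0F) (hubStar a 0F) top≡0 (edge (up a top) ++ʷ edge (down i top))
        (λ { zero → λ () ; (suc j′) → node-slot-≢ a top i (child 0F j′) λ () })
        (suc j) child≡last 4≤last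
        λ { zero → λ () ; (suc j′) → node-branch-≢ a (child 0F j′) i (child 0F j) (other-≢ i) }
      where
      a = other i

    no-colouring : ⊥
    no-colouring with star-has-zero rootStar
    ... | inj₁ root≡0        = root-≢zero root≡0
    ... | inj₂ (i , top≡0)  = top-≢zero i top≡0

  not-colourable : ¬ SPackingColorable tree (seqS k)
  not-colourable (_ , isColouring) = no-colouring isColouring

proposition6 : (k : ℕ) → 3 ≤ k →
    Σ Graph λ G → Bipartite G × Outerplanar G × MaxDegreeAtMost G k
      × ¬ SPackingColorable G (seqS k)
proposition6 (suc (suc (suc k′))) (s≤s (s≤s (s≤s z≤n))) =
  tree , bipartite , outerplanar , max-degree , not-colourable
  where open Counterexample k′
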